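{- For all integers $n \geq 3$ and $1 \leq k < n/2$, $\beta_E(GP(n,k)) \geq 3$.
   Context: The generalized Petersen graph $GP(n,k)$, for $n\ge 3$ and $1\le k<n/2$, has vertex set $\{u_i, v_i : 0\le i\le n-1\}$ and edge set $\{u_iu_{i+1}, u_iv_i, v_iv_{i+k} : 0\le i\le n-1\}$, indices taken modulo $n$. For vertices $u,v$, $d(u,v)$ is the shortest-path distance; for a vertex $w$ and edge $uv$, $d(w,uv)=\min\{d(w,u),d(w,v)\}$. A vertex $w$ resolves edges $e_1,e_2$ if $d(w,e_1)\ne d(w,e_2)$. A vertex set $S$ is an edge metric generator if every two distinct edges are resolved by some vertex of $S$; the edge metric dimension $\beta_E(G)$ is the minimum cardinality of an edge metric generator of $G$. -}

module Defs where

open import Data.Nat using (ℕ; zero; suc; _+_; _⊓_; _≤_; NonZero)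
open import Data.Nat.DivMod using (_%_; m%n<n)
open import Data.Fin using (Fin; toℕ; fromℕ<)
open import Data.Product using (_×_; _,_; ∃; ∃-syntax; proj₁; proj₂)
open import Data.Sum using (_⊎_)
open import Data.List using (List)
open import Data.List.Membership.Propositional using (_∈_)
open import Relation.Binary.PropositionalEquality using (_≡_; _≢_)

_⊕_ : {n : ℕ} .{{_ : NonZero n}} → Fin n → ℕ → Fin n
_⊕_ {n} i j = fromℕ< (m%n<n (toℕ i + j) n)

data Vertex (n : ℕ) : Set where
  u : Fin n → Vertex n
  v : Fin n → Vertex n

-- Edges of GP(n,k), labelled: outer u_i u_{i+1}, spoke u_i v_i, inner v_i v_{i+k}.
data Edge (n : ℕ) : Set where
  outer : Fin n → Edge n
  spoke : Fin n → Edge n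
  inner : Fin n → Edge n

module GP (n k : ℕ) .{{_ : NonZero n}} where

  ends : Edge n → Vertex n × Vertex n
  ends (outer i) = u i , u (i ⊕ 1)
  ends (spoke i) = u i , v i
  ends (inner i) = v i , v (i ⊕ k)

  Adj : Vertex n → Vertex n → Set
  Adj x y = ∃[ e ] (ends e ≡ (x , y) ⊎ ends e ≡ (y , x))

  data Walk : Vertex n → Vertex n → ℕ → Set where
    here : ∀ {x} → Walk x x zero
    step : ∀ {x y z m} → Adj x y → Walk y z m → Walk x z (suc m)

  Dist : Vertex n → Vertex n → ℕ → Set
  Dist x y m = Walk x y m × (∀ m' → Walk x y m' → m ≤ m')

  EdgeDist : Vertex n → Edge n → ℕ → Set
  EdgeDist w e m = ∃[ d₁ ] ∃[ d₂ ]
    (Dist w (proj₁ (ends e)) d₁ × Dist w (proj₂ (ends e)) d₂ × m ≡ d₁ ⊓ d₂)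

  Resolves : Vertex n → Edge n → Edge n → Set
  Resolves w e₁ e₂ = ∀ m₁ m₂ → EdgeDist w e₁ m₁ → EdgeDist w e₂ m₂ → m₁ ≢ m₂

  EdgeMetricGenerator : List (Vertex n) → Set
  EdgeMetricGenerator S = ∀ e₁ e₂ → e₁ ≢ e₂ → ∃[ w ] (w ∈ S × Resolves w e₁ e₂)

-- Every vertex w of GP(n,k) lies on three distinct edges, all at edge distance 0 from w.
-- From any vertex w', an edge wx is at distance min(d(w',w), d(w',x)), which is d(w',w) or
-- d(w',w) − 1 because w and x are adjacent; so two of the three edges at w are also at the
-- same distance from w'. Hence no set {w, w'} is an edge metric generator.
module Submission where

open import Defs
open import Data.Nat using (ℕ; _≤_; _<_; _*_; NonZero)
open import Data.List using (List; length)
open import Data.Nat using (zero; suc; _+_; _∸_; _⊓_; z≤n; s≤s; _<?_; _≤?_; z<s; >-nonZero⁻¹)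
open import Data.Nat.Properties
open import Data.Nat.DivMod using (_%_; m%n<n; %-distribˡ-+; m%n%n≡m%n; m<n⇒m%n≡m; m≤n⇒[n∸m]%m≡n%m; n%n≡0; [m+n]%n≡m%n)
open import Data.Fin using (Fin; toℕ; fromℕ<) renaming (_≟_ to _≟ᶠ_)
open import Data.Fin.Properties using (toℕ-injective; toℕ-fromℕ<; toℕ<n; any?)
open import Data.Product using (_×_; _,_; ∃; ∃-syntax; proj₂)
open import Data.Product.Properties using (≡-dec)
open import Data.Sum using (_⊎_; inj₁; inj₂)
open import Data.Empty using (⊥-elim)
open import Function using (_∘_)
open import Data.List using ([]; _∷_)
open import Data.List.Relation.Unary.Any using (here; there)
open import Relation.Nullary using (¬_; Dec; yes; no)
open import Relation.Nullary.Decidable using (_×-dec_; _⊎-dec_; map′)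
open import Relation.Binary.PropositionalEquality

Least : (ℕ → Set) → Set
Least P = ∃[ m ] (P m × (∀ m′ → P m′ → m ≤ m′))

module _ {P : ℕ → Set} (P? : ∀ m → Dec (P m)) where

  least-above : ∀ fuel j → (∀ m → m < j → ¬ P m) → P (fuel + j) → Least P
  least-above fuel j below p with P? j
  ... | yes pj = j , pj , λ m′ pm′ → ≮⇒≥ λ m′<j → below m′ m′<j pm′
  least-above zero       j below p | no ¬pj = ⊥-elim (¬pj p)
  least-above (suc fuel) j below p | no ¬pj = least-above fuel (suc j) below′ (subst P (sym (+-suc fuel j)) p)
    where
      below′ : ∀ m → m < suc j → ¬ P m
      below′ m m<1+j with m<1+n⇒m<n∨m≡n m<1+j
      ... | inj₁ m<j  = below m m<j
      ... | inj₂ refl = ¬pj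

  least : ∀ {m} → P m → Least P
  least {m} pm = least-above m 0 (λ _ ()) (subst P (sym (+-identityʳ m)) pm)

two-of-three-equal : ∀ {D a b c} → a ≡ D ⊎ suc a ≡ D → b ≡ D ⊎ suc b ≡ D → c ≡ D ⊎ suc c ≡ D →
                     a ≡ b ⊎ a ≡ c ⊎ b ≡ c
two-of-three-equal (inj₁ a≡D)  (inj₁ b≡D)  _           = inj₁ (trans a≡D (sym b≡D))
two-of-three-equal (inj₂ a+1≡D) (inj₂ b+1≡D) _          = inj₁ (suc-injective (trans a+1≡D (sym b+1≡D)))
two-of-three-equal (inj₁ a≡D)  (inj₂ _)    (inj₁ c≡D)   = inj₂ (inj₁ (trans a≡D (sym c≡D)))
two-of-three-equal (inj₁ _)    (inj₂ b+1≡D) (inj₂ c+1≡D) = inj₂ (inj₂ (suc-injective (trans b+1≡D (sym c+1≡D))))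
two-of-three-equal (inj₂ _)    (inj₁ b≡D)  (inj₁ c≡D)   = inj₂ (inj₂ (trans b≡D (sym c≡D)))
two-of-three-equal (inj₂ a+1≡D) (inj₁ _)   (inj₂ c+1≡D) = inj₂ (inj₁ (suc-injective (trans a+1≡D (sym c+1≡D))))

module _ {n : ℕ} .{{_ : NonZero n}} where

  toℕ-⊕ : ∀ (i : Fin n) j → toℕ (i ⊕ j) ≡ (toℕ i + j) % n
  toℕ-⊕ i j = toℕ-fromℕ< (m%n<n (toℕ i + j) n)

  [m%n+o]%n≡[m+o]%n : ∀ m o → (m % n + o) % n ≡ (m + o) % n
  [m%n+o]%n≡[m+o]%n m o = begin
    (m % n + o) % n          ≡⟨ %-distribˡ-+ (m % n) o n ⟩
    (m % n % n + o % n) % n  ≡⟨ cong (λ t → (t + o % n) % n) (m%n%n≡m%n m n) ⟩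
    (m % n + o % n) % n      ≡⟨ %-distribˡ-+ m o n ⟨
    (m + o) % n              ∎
    where open ≡-Reasoning

  ⊕-assoc : ∀ (i : Fin n) a b → (i ⊕ a) ⊕ b ≡ i ⊕ (a + b)
  ⊕-assoc i a b = toℕ-injective (begin
    toℕ ((i ⊕ a) ⊕ b)          ≡⟨ toℕ-⊕ (i ⊕ a) b ⟩
    (toℕ (i ⊕ a) + b) % n      ≡⟨ cong (λ t → (t + b) % n) (toℕ-⊕ i a) ⟩
    ((toℕ i + a) % n + b) % n  ≡⟨ [m%n+o]%n≡[m+o]%n (toℕ i + a) b ⟩
    (toℕ i + a + b) % n        ≡⟨ cong (_% n) (+-assoc (toℕ i) a b) ⟩
    (toℕ i + (a + b)) % n      ≡⟨ toℕ-⊕ i (a + b) ⟨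
    toℕ (i ⊕ (a + b))          ∎)
    where open ≡-Reasoning

  ⊕-identityʳ : ∀ (i : Fin n) → i ⊕ 0 ≡ i
  ⊕-identityʳ i = toℕ-injective (begin
    toℕ (i ⊕ 0)        ≡⟨ toℕ-⊕ i 0 ⟩
    (toℕ i + 0) % n    ≡⟨ cong (_% n) (+-identityʳ (toℕ i)) ⟩
    toℕ i % n          ≡⟨ m<n⇒m%n≡m (toℕ<n i) ⟩
    toℕ i              ∎)
    where open ≡-Reasoning

  i⊕n≡i : ∀ (i : Fin n) → i ⊕ n ≡ i
  i⊕n≡i i = toℕ-injective (begin
    toℕ (i ⊕ n)        ≡⟨ toℕ-⊕ i n ⟩
    (toℕ i + n) % n    ≡⟨ [m+n]%n≡m%n (toℕ i) n ⟩
    toℕ i % n          ≡⟨ m<n⇒m%n≡m (toℕ<n i) ⟩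
    toℕ i              ∎)
    where open ≡-Reasoning

  i⊕[n∸c]⊕c≡i : ∀ (i : Fin n) c → c ≤ n → (i ⊕ (n ∸ c)) ⊕ c ≡ i
  i⊕[n∸c]⊕c≡i i c c≤n = begin
    (i ⊕ (n ∸ c)) ⊕ c  ≡⟨ ⊕-assoc i (n ∸ c) c ⟩
    i ⊕ (n ∸ c + c)    ≡⟨ cong (i ⊕_) (m∸n+n≡m c≤n) ⟩
    i ⊕ n              ≡⟨ i⊕n≡i i ⟩
    i                  ∎
    where open ≡-Reasoning

  ⊕-[n∸toℕ]≡0 : ∀ (i : Fin n) → toℕ (i ⊕ (n ∸ toℕ i)) ≡ 0
  ⊕-[n∸toℕ]≡0 i = begin
    toℕ (i ⊕ (n ∸ toℕ i))      ≡⟨ toℕ-⊕ i (n ∸ toℕ i) ⟩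
    (toℕ i + (n ∸ toℕ i)) % n  ≡⟨ cong (_% n) (m+[n∸m]≡n (<⇒≤ (toℕ<n i))) ⟩
    n % n                      ≡⟨ n%n≡0 n ⟩
    0                          ∎
    where open ≡-Reasoning

  -- Either i + c < n and then i ⊕ c = i + c ≠ i, or i ⊕ c = i + c − n, which is i only if c = n.
  i⊕c≢i : ∀ (i : Fin n) c → 0 < c → c < n → i ⊕ c ≢ i
  i⊕c≢i i zero () _
  i⊕c≢i i c@(suc _) _ c<n i⊕c≡i with toℕ i + c <? n
  ... | yes i+c<n = m+1+n≢m (toℕ i) (begin
    toℕ i + c          ≡⟨ m<n⇒m%n≡m i+c<n ⟨
    (toℕ i + c) % n    ≡⟨ toℕ-⊕ i c ⟨
    toℕ (i ⊕ c)        ≡⟨ cong toℕ i⊕c≡i ⟩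
    toℕ i              ∎)
    where open ≡-Reasoning
  ... | no i+c≮n = <-irrefl c≡n c<n
    where
      open ≡-Reasoning
      n≤i+c : n ≤ toℕ i + c
      n≤i+c = ≮⇒≥ i+c≮n
      i+c∸n<n : toℕ i + c ∸ n < n
      i+c∸n<n = +-cancelʳ-< n (toℕ i + c ∸ n) n
        (subst (_< n + n) (sym (m∸n+n≡m n≤i+c)) (+-mono-< (toℕ<n i) c<n))
      i+c∸n≡i : toℕ i + c ∸ n ≡ toℕ i
      i+c∸n≡i = begin
        toℕ i + c ∸ n          ≡⟨ m<n⇒m%n≡m i+c∸n<n ⟨
        (toℕ i + c ∸ n) % n    ≡⟨ m≤n⇒[n∸m]%m≡n%m n≤i+c ⟩
        (toℕ i + c) % n        ≡⟨ toℕ-⊕ i c ⟨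
        toℕ (i ⊕ c)            ≡⟨ cong toℕ i⊕c≡i ⟩
        toℕ i                  ∎
      c≡n : c ≡ n
      c≡n = +-cancelˡ-≡ (toℕ i) c n (begin
        toℕ i + c              ≡⟨ m∸n+n≡m n≤i+c ⟨
        toℕ i + c ∸ n + n      ≡⟨ cong (_+ n) i+c∸n≡i ⟩
        toℕ i + n              ∎)

module _ (n k : ℕ) .{{_ : NonZero n}} where
  open GP n k

  u-injective : ∀ {i j : Fin n} → Vertex.u i ≡ u j → i ≡ j
  u-injective refl = refl

  v-injective : ∀ {i j : Fin n} → Vertex.v i ≡ v j → i ≡ j
  v-injective refl = refl

  outer-injective : ∀ {i j : Fin n} → Edge.outer i ≡ outer j → i ≡ j
  outer-injective refl = refl

  inner-injective : ∀ {i j : Fin n} → Edge.inner i ≡ inner j → i ≡ j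
  inner-injective refl = refl

  _≟ᵛ_ : (x y : Vertex n) → Dec (x ≡ y)
  u i ≟ᵛ u j = map′ (cong u) u-injective (i ≟ᶠ j)
  u i ≟ᵛ v j = no (λ ())
  v i ≟ᵛ u j = no (λ ())
  v i ≟ᵛ v j = map′ (cong v) v-injective (i ≟ᶠ j)

  anyVertex? : {P : Vertex n → Set} → (∀ x → Dec (P x)) → Dec (∃ P)
  anyVertex? P? with any? (P? ∘ u) | any? (P? ∘ v)
  ... | yes (i , p) | _           = yes (u i , p)
  ... | no _        | yes (i , p) = yes (v i , p)
  ... | no ¬u       | no ¬v       = no λ { (u i , p) → ¬u (i , p) ; (v i , p) → ¬v (i , p) }

  anyEdge? : {P : Edge n → Set} → (∀ e → Dec (P e)) → Dec (∃ P)
  anyEdge? P? with any? (P? ∘ outer) | any? (P? ∘ spoke) | any? (P? ∘ inner)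
  ... | yes (i , p) | _           | _           = yes (outer i , p)
  ... | no _        | yes (i , p) | _           = yes (spoke i , p)
  ... | no _        | no _        | yes (i , p) = yes (inner i , p)
  ... | no ¬o       | no ¬s       | no ¬i       =
    no λ { (outer i , p) → ¬o (i , p) ; (spoke i , p) → ¬s (i , p) ; (inner i , p) → ¬i (i , p) }

  adjacent? : ∀ x y → Dec (Adj x y)
  adjacent? x y = anyEdge? λ e → ≡-dec _≟ᵛ_ _≟ᵛ_ (ends e) (x , y) ⊎-dec ≡-dec _≟ᵛ_ _≟ᵛ_ (ends e) (y , x)

  walk? : ∀ m x y → Dec (Walk x y m)
  walk? zero x y with x ≟ᵛ y
  ... | yes refl = yes here
  ... | no x≢y   = no λ { here → x≢y refl }
  walk? (suc m) x y with anyVertex? (λ z → adjacent? x z ×-dec walk? m z y)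
  ... | yes (_ , xz , zy) = yes (step xz zy)
  ... | no ¬path          = no λ { (step xz zy) → ¬path (_ , xz , zy) }

  Adj-sym : ∀ {x y} → Adj x y → Adj y x
  Adj-sym (e , inj₁ p) = e , inj₂ p
  Adj-sym (e , inj₂ p) = e , inj₁ p

  _++ʷ_ : ∀ {x y z a b} → Walk x y a → Walk y z b → Walk x z (a + b)
  here        ++ʷ q = q
  step xy p   ++ʷ q = step xy (p ++ʷ q)

  _∷ʳʷ_ : ∀ {x y z a} → Walk x y a → Adj y z → Walk x z (suc a)
  _∷ʳʷ_ {a = a} p yz = subst (Walk _ _) (+-comm a 1) (p ++ʷ step yz here)

  reverseʷ : ∀ {x y a} → Walk x y a → Walk y x a
  reverseʷ here        = here
  reverseʷ (step xy p) = reverseʷ p ∷ʳʷ Adj-sym xy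

  origin : Fin n
  origin = fromℕ< (>-nonZero⁻¹ n)

  outerWalk : ∀ j i → Walk (u i) (u (i ⊕ j)) j
  outerWalk zero    i = subst (λ t → Walk (u i) (u t) 0) (sym (⊕-identityʳ i)) here
  outerWalk (suc j) i = step (outer i , inj₁ refl)
    (subst (λ t → Walk (u (i ⊕ 1)) (u t) j) (⊕-assoc i 1 j) (outerWalk j (i ⊕ 1)))

  walkToOrigin : ∀ x → ∃[ m ] Walk x (u origin) m
  walkToOrigin (u i) = n ∸ toℕ i , subst (λ t → Walk (u i) (u t) (n ∸ toℕ i)) i⊕[n∸i]≡origin (outerWalk (n ∸ toℕ i) i)
    where
      i⊕[n∸i]≡origin : i ⊕ (n ∸ toℕ i) ≡ origin
      i⊕[n∸i]≡origin = toℕ-injective (trans (⊕-[n∸toℕ]≡0 i) (sym (toℕ-fromℕ< _)))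
  walkToOrigin (v i) with walkToOrigin (u i)
  ... | m , p = suc m , step (spoke i , inj₂ refl) p

  connected : ∀ x y → ∃[ m ] Walk x y m
  connected x y with walkToOrigin x | walkToOrigin y
  ... | _ , p | _ , q = _ , p ++ʷ reverseʷ q

  shortest : ∀ x y → ∃ (Dist x y)
  shortest x y = least (λ m → walk? m x y) (proj₂ (connected x y))

  Joins : Vertex n → Edge n → Vertex n → Set
  Joins w e x = ends e ≡ (w , x) ⊎ ends e ≡ (x , w)

  edgeDist-joins : ∀ {w e x w′ D D′} → Joins w e x → Dist w′ w D → Dist w′ x D′ → EdgeDist w′ e (D ⊓ D′)
  edgeDist-joins {D = D} {D′} (inj₁ p) dw dx rewrite p = D , D′ , dw , dx , refl
  edgeDist-joins {D = D} {D′} (inj₂ p) dw dx rewrite p = D′ , D , dx , dw , ⊓-comm D D′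

  edgeDist-incident : ∀ {w e x} → Joins w e x → EdgeDist w e 0
  edgeDist-incident {w} {x = x} j = edgeDist-joins j (here , λ _ _ → z≤n) (proj₂ (shortest w x))

  ⊓-dist-adjacent : ∀ {w x w′ D D′} → Dist w′ w D → Adj w x → Dist w′ x D′ →
                    D ⊓ D′ ≡ D ⊎ suc (D ⊓ D′) ≡ D
  ⊓-dist-adjacent {D = D} {D′} (_ , w-shortest) wx (x-walk , _) with D ≤? D′
  ... | yes D≤D′ = inj₁ (m≤n⇒m⊓n≡m D≤D′)
  ... | no D≰D′  = inj₂ (trans (cong suc (m≥n⇒m⊓n≡n (<⇒≤ D′<D)))
                               (≤-antisym D′<D (w-shortest (suc D′) (x-walk ∷ʳʷ Adj-sym wx))))
    where D′<D = ≰⇒> D≰D′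

  edgeDist-near : ∀ {w e x w′ D} → Joins w e x → Dist w′ w D →
                  ∃[ m ] (EdgeDist w′ e m × (m ≡ D ⊎ suc m ≡ D))
  edgeDist-near {x = x} {w′} {D} j dw with shortest w′ x
  ... | D′ , dx = D ⊓ D′ , edgeDist-joins j dw dx , ⊓-dist-adjacent dw (_ , j) dx

  record ThreeEdgesAt (w : Vertex n) : Set where
    field
      e₁ e₂ e₃ : Edge n
      x₁ x₂ x₃ : Vertex n
      joins₁ : Joins w e₁ x₁
      joins₂ : Joins w e₂ x₂
      joins₃ : Joins w e₃ x₃
      e₁≢e₂ : e₁ ≢ e₂
      e₁≢e₃ : e₁ ≢ e₃
      e₂≢e₃ : e₂ ≢ e₃

  threeEdgesAt : 2 ≤ n → 0 < k → k < n → ∀ w → ThreeEdgesAt w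
  threeEdgesAt 2≤n 0<k k<n (u i) = record
    { e₁ = outer i ; e₂ = spoke i ; e₃ = outer (i ⊕ (n ∸ 1))
    ; joins₁ = inj₁ refl ; joins₂ = inj₁ refl
    ; joins₃ = inj₂ (cong (λ j → u (i ⊕ (n ∸ 1)) , u j) (i⊕[n∸c]⊕c≡i i 1 1≤n))
    ; e₁≢e₂ = λ () ; e₂≢e₃ = λ ()
    ; e₁≢e₃ = λ eq → i⊕c≢i i (n ∸ 1) (m<n⇒0<n∸m 2≤n) (∸-monoʳ-< z<s 1≤n) (sym (outer-injective eq))
    }
    where 1≤n = ≤-trans (s≤s z≤n) 2≤n
  threeEdgesAt 2≤n 0<k k<n (v i) = record
    { e₁ = inner i ; e₂ = spoke i ; e₃ = inner (i ⊕ (n ∸ k))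
    ; joins₁ = inj₁ refl ; joins₂ = inj₂ refl
    ; joins₃ = inj₂ (cong (λ j → v (i ⊕ (n ∸ k)) , v j) (i⊕[n∸c]⊕c≡i i k (<⇒≤ k<n)))
    ; e₁≢e₂ = λ () ; e₂≢e₃ = λ ()
    ; e₁≢e₃ = λ eq → i⊕c≢i i (n ∸ k) (m<n⇒0<n∸m k<n) (∸-monoʳ-< 0<k (<⇒≤ k<n)) (sym (inner-injective eq))
    }

  data Unresolved (w : Vertex n) (e e′ : Edge n) : Set where
    same-distance : ∀ {m} → EdgeDist w e m → EdgeDist w e′ m → Unresolved w e e′

  unresolved⇒¬resolves : ∀ {w e e′} → Unresolved w e e′ → ¬ Resolves w e e′
  unresolved⇒¬resolves (same-distance de de′) resolves = resolves _ _ de de′ refl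

  unresolved-incident : ∀ {w e e′ x x′} → Joins w e x → Joins w e′ x′ → Unresolved w e e′
  unresolved-incident j j′ = same-distance (edgeDist-incident j) (edgeDist-incident j′)

  module _ {w} (T : ThreeEdgesAt w) where
    open ThreeEdgesAt T

    unresolvedPair : ∀ w′ → ∃[ e ] ∃[ e′ ] (e ≢ e′ × Unresolved w e e′ × Unresolved w′ e e′)
    unresolvedPair w′
      with dw ← proj₂ (shortest w′ w)
      with _ , d₁ , near₁ ← edgeDist-near joins₁ dw
         | _ , d₂ , near₂ ← edgeDist-near joins₂ dw
         | _ , d₃ , near₃ ← edgeDist-near joins₃ dw
      with two-of-three-equal near₁ near₂ near₃
    ... | inj₁ refl        = e₁ , e₂ , e₁≢e₂ , unresolved-incident joins₁ joins₂ , same-distance d₁ d₂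
    ... | inj₂ (inj₁ refl) = e₁ , e₃ , e₁≢e₃ , unresolved-incident joins₁ joins₃ , same-distance d₁ d₃
    ... | inj₂ (inj₂ refl) = e₂ , e₃ , e₂≢e₃ , unresolved-incident joins₂ joins₃ , same-distance d₂ d₃

  edgeMetricGenerator⇒3≤length : (∀ w → ThreeEdgesAt w) → ∀ S → EdgeMetricGenerator S → 3 ≤ length S
  edgeMetricGenerator⇒3≤length _     []           gen with gen (outer origin) (spoke origin) (λ ())
  ... | _ , () , _
  edgeMetricGenerator⇒3≤length three (w ∷ [])      gen
    with e , e′ , e≢e′ , unres , _ ← unresolvedPair (three w) w
    with gen e e′ e≢e′
  ... | _ , here refl , res = ⊥-elim (unresolved⇒¬resolves unres res)
  edgeMetricGenerator⇒3≤length three (w ∷ w′ ∷ [])  gen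
    with e , e′ , e≢e′ , unres , unres′ ← unresolvedPair (three w) w′
    with gen e e′ e≢e′
  ... | _ , here refl , res         = ⊥-elim (unresolved⇒¬resolves unres res)
  ... | _ , there (here refl) , res = ⊥-elim (unresolved⇒¬resolves unres′ res)
  edgeMetricGenerator⇒3≤length _     (_ ∷ _ ∷ _ ∷ _) _   = s≤s (s≤s (s≤s z≤n))

mainTheorem3 : (n k : ℕ) .{{_ : NonZero n}} → 3 ≤ n → 1 ≤ k → 2 * k < n →
    (S : List (Vertex n)) → GP.EdgeMetricGenerator n k S → 3 ≤ length S
mainTheorem3 n k 3≤n 1≤k 2k<n =
  edgeMetricGenerator⇒3≤length n k (threeEdgesAt n k (≤-trans (n≤1+n 2) 3≤n) 1≤k k<n)
  where
    k<n : k < n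
    k<n = ≤-<-trans (m≤m+n k (k + 0)) 2k<n
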